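{- Let $\mathcal{L}$ be a finite language (generated by finitely many propositional variables). A choice revision $\ast_c$ on $K$ satisfies, for all finite $A,B\subseteq\mathcal{L}$, (closure) $\mathrm{Cn}(K\ast_c A)=K\ast_c A$; (relative success) $K\ast_c A=K$ or $A\cap(K\ast_c A)\neq\emptyset$; (regularity) if $A\cap(K\ast_c B)\neq\emptyset$ then $A\cap(K\ast_c A)\neq\emptyset$; (confirmation) if $A\cap K\neq\emptyset$ then $K\ast_c A=K$; (reciprocity) if $(K\ast_c A)\cap B\neq\emptyset$ and $(K\ast_c B)\cap A\neq\emptyset$ then $K\ast_c A=K\ast_c B$, if and only if $\ast_c$ is the choice revision determined by some relational model with respect to $K$.
   Context: $\mathcal{L}$ is a propositional language generated by a set of propositional variables with $\neg,\wedge,\vee,\rightarrow$. $\mathrm{Cn}$ is a consequence operation on $\mathcal{L}$ that is supraclassical, compact and satisfies the deduction property. A belief set is $X\subseteq\mathcal{L}$ with $X=\mathrm{Cn}(X)$. $K$ is a fixed consistent belief set. A choice revision on $K$ is a function $\ast_c$ assigning to each finite $A\subseteq\mathcal{L}$ a set $K\ast_c A\subseteq\mathcal{L}$. Belief descriptors: an atomic descriptor is $\mathfrak{B}\varphi$ ($\varphi\in\mathcal{L}$); molecular descriptors are truth-functional combinations of atomic ones; a descriptor is a set of molecular descriptors. A belief set $X$ satisfies $\mathfrak{B}\varphi$ iff $\varphi\in X$, satisfaction extends truth-functionally, and $X$ satisfies a descriptor iff it satisfies all its elements. A relational model with respect to $K$ is a pair $(\mathbb{X},\leqq)$ where $\mathbb{X}$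 is a set of belief sets with $K\in\mathbb{X}$, $\leqq$ is a binary relation on $\mathbb{X}$ with $K\leqq X$ for all $X\in\mathbb{X}$, and for every descriptor $\Phi$, if the set of elements of $\mathbb{X}$ satisfying $\Phi$ is nonempty then it has a unique $\leqq$-minimal element. For nonempty finite $A=\{\varphi_0,\dots,\varphi_n\}$, a belief set satisfies $\{\mathfrak{B}\varphi_0\vee\cdots\vee\mathfrak{B}\varphi_n\}$ iff $X\cap A\neq\emptyset$; write $\mathbb{X}_A=\{X\in\mathbb{X}\mid X\cap A\neq\emptyset\}$. The choice revision determined by $(\mathbb{X},\leqq)$ is: $K\ast_c A$ is the unique $\leqq$-minimal element of $\mathbb{X}_A$ if $A\neq\emptyset$ and $\mathbb{X}_A\neq\emptyset$, and $K\ast_c A=K$ otherwise. -}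

module Defs where

open import Level using (0ℓ)
open import Data.Nat using (ℕ)
open import Data.Fin using (Fin)
open import Data.Bool using (Bool; true; false; not; _∧_; _∨_)
open import Data.List using (List; []; _∷_)
open import Data.List.Membership.Propositional using (_∈_)
open import Data.Product using (Σ; ∃; _×_; _,_)
open import Data.Sum using (_⊎_)
open import Data.Empty using (⊥)
open import Relation.Nullary using (¬_)
open import Relation.Binary.PropositionalEquality using (_≡_)

data Formula (n : ℕ) : Set where
  var  : Fin n → Formula n
  ¬'_  : Formula n → Formula n
  _∧'_ : Formula n → Formula n → Formula n
  _∨'_ : Formula n → Formula n → Formula n
  _⇒'_ : Formula n → Formula n → Formula n

FSet : ℕ → Set₁
FSet n = Formula n → Set

_⊆_ : ∀ {n} → FSet n → FSet n → Set
X ⊆ Y = ∀ φ → X φ → Y φ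

_≐_ : ∀ {n} → FSet n → FSet n → Set
X ≐ Y = (X ⊆ Y) × (Y ⊆ X)

_∪｛_｝ : ∀ {n} → FSet n → Formula n → FSet n
(X ∪｛ φ ｝) ψ = X ψ ⊎ (ψ ≡ φ)

⟦_⟧ : ∀ {n} → List (Formula n) → FSet n
⟦ A ⟧ φ = φ ∈ A

Meets : ∀ {n} → List (Formula n) → FSet n → Set
Meets A X = ∃ λ φ → (φ ∈ A) × X φ

eval : ∀ {n} → (Fin n → Bool) → Formula n → Bool
eval v (var i)   = v i
eval v (¬' φ)    = not (eval v φ)
eval v (φ ∧' ψ)  = eval v φ ∧ eval v ψ
eval v (φ ∨' ψ)  = eval v φ ∨ eval v ψ
eval v (φ ⇒' ψ)  = not (eval v φ) ∨ eval v ψ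

Cn₀ : ∀ {n} → FSet n → FSet n
Cn₀ X φ = (v : Fin _ → Bool) → (∀ ψ → X ψ → eval v ψ ≡ true) → eval v φ ≡ true

record IsCn {n : ℕ} (Cn : FSet n → FSet n) : Set₁ where
  field
    inclusion     : ∀ X → X ⊆ Cn X
    monotony      : ∀ X Y → X ⊆ Y → Cn X ⊆ Cn Y
    iteration     : ∀ X → Cn (Cn X) ⊆ Cn X
    supraclassical : ∀ X → Cn₀ X ⊆ Cn X
    compact       : ∀ X φ → Cn X φ →
                    Σ (List (Formula n)) λ Y → (⟦ Y ⟧ ⊆ X) × Cn ⟦ Y ⟧ φ
    deduction     : ∀ X φ ψ → (Cn (X ∪｛ φ ｝) ψ → Cn X (φ ⇒' ψ))
                              × (Cn X (φ ⇒' ψ) → Cn (X ∪｛ φ ｝) ψ)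

IsBeliefSet : ∀ {n} → (FSet n → FSet n) → FSet n → Set
IsBeliefSet Cn X = Cn X ≐ X

Consistent : ∀ {n} → FSet n → Set
Consistent X = ¬ (∀ φ → X φ)

ChoiceRevision : ℕ → Set₁
ChoiceRevision n = List (Formula n) → FSet n

data MolDesc (n : ℕ) : Set where
  𝔅    : Formula n → MolDesc n
  ¬ᵈ_  : MolDesc n → MolDesc n
  _∧ᵈ_ : MolDesc n → MolDesc n → MolDesc n
  _∨ᵈ_ : MolDesc n → MolDesc n → MolDesc n
  _⇒ᵈ_ : MolDesc n → MolDesc n → MolDesc n

Descriptor : ℕ → Set₁
Descriptor n = MolDesc n → Set

SatM : ∀ {n} → FSet n → MolDesc n → Set
SatM X (𝔅 φ)    = X φ
SatM X (¬ᵈ d)   = ¬ SatM X d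
SatM X (d ∧ᵈ e) = SatM X d × SatM X e
SatM X (d ∨ᵈ e) = SatM X d ⊎ SatM X e
SatM X (d ⇒ᵈ e) = SatM X d → SatM X e

Sat : ∀ {n} → FSet n → Descriptor n → Set
Sat X Φ = ∀ d → Φ d → SatM X d

BSets : ℕ → Set₂
BSets n = FSet n → Set₁

IsMinimal : ∀ {n} → (FSet n → FSet n → Set₁) → BSets n → FSet n → Set₁
IsMinimal _≦_ S X = S X × (∀ Y → S Y → Y ≦ X → X ≦ Y)

HasUniqueMin : ∀ {n} → (FSet n → FSet n → Set₁) → BSets n → Set₁
HasUniqueMin _≦_ S =
  Σ (FSet _) λ X → IsMinimal _≦_ S X × (∀ Y → IsMinimal _≦_ S Y → Y ≐ X)

SatIn : ∀ {n} → BSets n → Descriptor n → BSets n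
SatIn 𝕏 Φ X = 𝕏 X × Sat X Φ

record RelModel {n : ℕ} (Cn : FSet n → FSet n) (K : FSet n) : Set₂ where
  field
    𝕏        : BSets n
    _≦_      : FSet n → FSet n → Set₁
    beliefSets : ∀ X → 𝕏 X → IsBeliefSet Cn X
    K∈𝕏      : 𝕏 K
    K≦       : ∀ X → 𝕏 X → K ≦ X
    uniqueMin : ∀ (Φ : Descriptor n) →
                (Σ (FSet n) λ X → SatIn 𝕏 Φ X) → HasUniqueMin _≦_ (SatIn 𝕏 Φ)

Restrict : ∀ {n} → BSets n → List (Formula n) → BSets n
Restrict 𝕏 A X = 𝕏 X × Meets A X

Determines : ∀ {n} {Cn : FSet n → FSet n} {K : FSet n} →
             RelModel Cn K → ChoiceRevision n → Set₁
Determines {n} {Cn} {K} M ∗c = ∀ (A : List (Formula n)) →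
    ((¬ (A ≡ []) × Σ (FSet n) (λ X → (Restrict 𝕏 A) X)) →
       Σ (FSet n) λ X → IsMinimal _≦_ (Restrict 𝕏 A) X × (∗c A ≐ X))
  × (((A ≡ []) ⊎ ¬ (Σ (FSet n) λ X → (Restrict 𝕏 A) X)) → ∗c A ≐ K)
  where open RelModel M

record ChoicePostulates {n : ℕ} (Cn : FSet n → FSet n) (K : FSet n)
                        (∗c : ChoiceRevision n) : Set₁ where
  field
    closure      : ∀ A → Cn (∗c A) ≐ ∗c A
    relSuccess   : ∀ A → (∗c A ≐ K) ⊎ Meets A (∗c A)
    regularity   : ∀ A B → Meets A (∗c B) → Meets A (∗c A)
    confirmation : ∀ A → Meets A K → ∗c A ≐ K
    reciprocity  : ∀ A B → Meets B (∗c A) → Meets A (∗c B) → ∗c A ≐ ∗c B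

-- Given the postulates, let 𝕏 consist of K and the successful outcomes
-- K ∗c A (those meeting A), and put X ≼ Y when X is K or X is K ∗c A for
-- some A that Y meets.  Regularity and reciprocity, applied to the choice
-- from A ++ B, make ≼ a total preorder on 𝕏 that is antisymmetric up to ≐,
-- and K ∗c A is the least element of 𝕏_A.  As the language is finite, a
-- belief set is determined by which of the finitely many truth tables it
-- contains, so every nonempty subfamily of 𝕏 has finitely many members up
-- to ≐ and therefore a least one.  Conversely, in a relational model K ∗c A
-- is the minimum of the elements satisfying 𝔅φ₀ ∨ ⋯ ∨ 𝔅φₙ.  Confirmation
-- holds because K is also minimal there, and reciprocity because both
-- choices are minimal for the descriptor containing both disjunctions.

module Submission where

open import Defs
open import Level using (0ℓ; Lift; lift; lower)
open import Data.Nat using (ℕ; zero; suc)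
open import Data.Fin using (Fin; zero; suc)
open import Data.Bool using (Bool; true; false; not; _∧_; _∨_)
open import Data.List using (List; []; _∷_; _++_; map; length)
open import Data.List.Properties using (length-map; ∷-injectiveˡ; ∷-injectiveʳ)
open import Data.List.Relation.Unary.Any as Any using (Any; here; there)
open import Data.List.Relation.Unary.Any.Properties using (++⁺ˡ; ++⁺ʳ; map⁺)
open import Data.List.Relation.Unary.All as All using (All; []; _∷_; lookupWith; lookupAny)
open import Data.List.Relation.Unary.All.Properties using (++⁺)
open import Data.List.Membership.Propositional using (_∈_)
open import Data.List.Membership.Propositional.Properties using (∈-++⁺ˡ; ∈-++⁺ʳ; ∈-++⁻; ∈-map⁺)
open import Data.Vec.Functional using (tail) renaming (_∷_ to _∷ᵥ_)
open import Data.Product using (Σ; ∃; _×_; _,_; proj₁; proj₂)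
open import Data.Sum using (_⊎_; inj₁; inj₂; [_,_])
open import Data.Empty using (⊥-elim)
open import Function using (id; _∘_)
open import Relation.Nullary using (¬_; Dec; yes; no)
open import Relation.Nullary.Decidable using (map′)
open import Relation.Binary.PropositionalEquality using (_≡_; _≗_; refl; sym; trans; cong; cong₂)
open import Axiom.ExcludedMiddle using (ExcludedMiddle)

private
  variable
    n : ℕ
    X Y Z : FSet n
    A B C : List (Formula n)

≐-refl : X ≐ X
≐-refl = (λ _ x → x) , (λ _ x → x)

≐-sym : X ≐ Y → Y ≐ X
≐-sym (X⊆Y , Y⊆X) = Y⊆X , X⊆Y

≐-trans : X ≐ Y → Y ≐ Z → X ≐ Z
≐-trans (X⊆Y , Y⊆X) (Y⊆Z , Z⊆Y) = (λ φ → Y⊆Z φ ∘ X⊆Y φ) , (λ φ → Y⊆X φ ∘ Z⊆Y φ)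

Meets-⊆ʳ : Meets A X → X ⊆ Y → Meets A Y
Meets-⊆ʳ (φ , φ∈A , xφ) X⊆Y = φ , φ∈A , X⊆Y φ xφ

Meets-⊆ˡ : Meets A X → ⟦ A ⟧ ⊆ ⟦ B ⟧ → Meets B X
Meets-⊆ˡ (φ , φ∈A , xφ) A⊆B = φ , A⊆B φ φ∈A , xφ

Meets-[] : ¬ Meets [] X
Meets-[] (_ , () , _)

Meets-++⁻ : ∀ A → Meets (A ++ B) X → Meets A X ⊎ Meets B X
Meets-++⁻ A (φ , φ∈A++B , xφ) =
  [ (λ φ∈A → inj₁ (φ , φ∈A , xφ)) , (λ φ∈B → inj₂ (φ , φ∈B , xφ)) ] (∈-++⁻ A φ∈A++B)

IsBeliefSet-resp-≐ : {Cn : FSet n → FSet n} → IsCn Cn →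
                     X ≐ Y → IsBeliefSet Cn Y → IsBeliefSet Cn X
IsBeliefSet-resp-≐ {X = X} {Y = Y} isCn (X⊆Y , Y⊆X) (CnY⊆Y , _) =
  (λ φ → Y⊆X φ ∘ CnY⊆Y φ ∘ IsCn.monotony isCn X Y X⊆Y φ) , IsCn.inclusion isCn X

valuations : ∀ n → List (Fin n → Bool)
valuations zero    = (λ ()) ∷ []
valuations (suc n) = map (true ∷ᵥ_) (valuations n) ++ map (false ∷ᵥ_) (valuations n)

∷ᵥ-≗ : ∀ {b} {v : Fin n → Bool} {w : Fin (suc n) → Bool} →
        w zero ≡ b → v ≗ tail w → (b ∷ᵥ v) ≗ w
∷ᵥ-≗ w₀ v≗ zero    = sym w₀
∷ᵥ-≗ w₀ v≗ (suc i) = v≗ i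

valuations-complete : ∀ n (w : Fin n → Bool) → Any (_≗ w) (valuations n)
valuations-complete zero    w = here (λ ())
valuations-complete (suc n) w with w zero in w₀
... | true  = ++⁺ˡ (map⁺ (Any.map (∷ᵥ-≗ w₀) (valuations-complete n (tail w))))
... | false = ++⁺ʳ _ (map⁺ (Any.map (∷ᵥ-≗ w₀) (valuations-complete n (tail w))))

eval-cong : ∀ {v w : Fin n → Bool} → v ≗ w → ∀ φ → eval v φ ≡ eval w φ
eval-cong v≗w (var i)  = v≗w i
eval-cong v≗w (¬' φ)   = cong not (eval-cong v≗w φ)
eval-cong v≗w (φ ∧' ψ) = cong₂ _∧_ (eval-cong v≗w φ) (eval-cong v≗w ψ)
eval-cong v≗w (φ ∨' ψ) = cong₂ _∨_ (eval-cong v≗w φ) (eval-cong v≗w ψ)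
eval-cong v≗w (φ ⇒' ψ) = cong₂ _∨_ (cong not (eval-cong v≗w φ)) (eval-cong v≗w ψ)

truthTable : Formula n → List Bool
truthTable {n} φ = map (λ v → eval v φ) (valuations n)

map-≡⇒All : ∀ {a b} {A′ : Set a} {B′ : Set b} {f g : A′ → B′} (xs : List A′) →
            map f xs ≡ map g xs → All (λ x → f x ≡ g x) xs
map-≡⇒All []       _  = []
map-≡⇒All (x ∷ xs) eq = ∷-injectiveˡ eq ∷ map-≡⇒All xs (∷-injectiveʳ eq)

truthTable-≡⇒equivalent : ∀ {φ ψ : Formula n} → truthTable φ ≡ truthTable ψ →
                           ∀ v → eval v φ ≡ eval v ψ
truthTable-≡⇒equivalent {n} {φ} {ψ} eq v =
  lookupWith (λ {u} uφ≡uψ u≗v → trans (sym (eval-cong u≗v φ)) (trans uφ≡uψ (eval-cong u≗v ψ)))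
             (map-≡⇒All (valuations n) eq) (valuations-complete n v)

boolLists : ℕ → List (List Bool)
boolLists zero    = [] ∷ []
boolLists (suc m) = map (true ∷_) (boolLists m) ++ map (false ∷_) (boolLists m)

∈-boolLists : ∀ m (bs : List Bool) → length bs ≡ m → bs ∈ boolLists m
∈-boolLists zero    []           refl = here refl
∈-boolLists (suc m) (true ∷ bs)  refl = ∈-++⁺ˡ (∈-map⁺ (true ∷_) (∈-boolLists m bs refl))
∈-boolLists (suc m) (false ∷ bs) refl =
  ∈-++⁺ʳ (map (true ∷_) (boolLists m)) (∈-map⁺ (false ∷_) (∈-boolLists m bs refl))

truthTable-∈ : (φ : Formula n) → truthTable φ ∈ boolLists (length (valuations n))
truthTable-∈ {n} φ = ∈-boolLists _ (truthTable φ) (length-map _ (valuations n))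

beliefSet-resp-truthTable : {Cn : FSet n → FSet n} → IsCn Cn → IsBeliefSet Cn X →
                            ∀ {φ ψ} → truthTable φ ≡ truthTable ψ → X φ → X ψ
beliefSet-resp-truthTable {X = X} isCn (CnX⊆X , _) {φ} {ψ} eq xφ =
  CnX⊆X ψ (IsCn.supraclassical isCn X ψ
    (λ v v⊨X → trans (sym (truthTable-≡⇒equivalent {φ = φ} {ψ} eq v)) (v⊨X φ xφ)))

-- Finitely many belief sets up to ≐

Representatives : (FSet n → Set₁) → Set₁
Representatives {n} S = Σ (List (FSet n)) λ Ws → All S Ws × (∀ X → S X → Any (X ≐_) Ws)

module _ (em : ExcludedMiddle (Level.suc 0ℓ)) where

  em₀ : {P : Set} → Dec P
  em₀ = map′ lower lift em

  Representatives-by-cases : {S : FSet n → Set₁} (P : FSet n → Set) →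
                             Representatives (λ X → S X × P X) →
                             Representatives (λ X → S X × ¬ P X) →
                             Representatives S
  Representatives-by-cases P (Ws₁ , all₁ , cover₁) (Ws₂ , all₂ , cover₂) =
    Ws₁ ++ Ws₂ , ++⁺ (All.map proj₁ all₁) (All.map proj₁ all₂) , cover
    where
    cover : ∀ X → _ → Any (X ≐_) (Ws₁ ++ Ws₂)
    cover X sX with em₀ {P X}
    ... | yes p = ++⁺ˡ (cover₁ X (sX , p))
    ... | no ¬p = ++⁺ʳ Ws₁ (cover₂ X (sX , ¬p))

  module _ {Key : Set} (key : Formula n → Key) where

    KeySaturated : FSet n → Set
    KeySaturated X = ∀ {φ ψ} → key φ ≡ key ψ → X φ → X ψ

    AgreeOutside : List Key → (FSet n → Set₁) → Set₁
    AgreeOutside T S = ∀ {X Y} → S X → S Y → ∀ φ → X φ → key φ ∈ T ⊎ Y φ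

    representatives : (T : List Key) (S : FSet n → Set₁) →
                      (∀ {X} → S X → KeySaturated X) → AgreeOutside T S →
                      Representatives S
    representatives [] S saturated agree with em {Σ (FSet n) S}
    ... | no ∄ = [] , [] , λ X sX → ⊥-elim (∄ (X , sX))
    ... | yes (W , sW) = W ∷ [] , sW ∷ [] , λ X sX → here (⊆-of sX sW , ⊆-of sW sX)
      where
      ⊆-of : ∀ {X Y} → S X → S Y → X ⊆ Y
      ⊆-of sX sY φ xφ = [ (λ ()) , id ] (agree sX sY φ xφ)
    representatives (t ∷ T) S saturated agree =
      Representatives-by-cases Hits
        (representatives T _ (saturated ∘ proj₁) agree-hit)
        (representatives T _ (saturated ∘ proj₁) agree-miss)
      where
      Hits : FSet n → Set
      Hits X = ∃ λ φ → X φ × key φ ≡ t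

      agree-hit : AgreeOutside T (λ X → S X × Hits X)
      agree-hit (sX , _) (sY , ψ , yψ , kψ) φ xφ with agree sX sY φ xφ
      ... | inj₁ (here kφ)   = inj₂ (saturated sY (trans kψ (sym kφ)) yψ)
      ... | inj₁ (there k∈T) = inj₁ k∈T
      ... | inj₂ yφ          = inj₂ yφ

      agree-miss : AgreeOutside T (λ X → S X × ¬ Hits X)
      agree-miss (sX , ¬hit) (sY , _) φ xφ with agree sX sY φ xφ
      ... | inj₁ (here kφ)   = ⊥-elim (¬hit (φ , xφ , kφ))
      ... | inj₁ (there k∈T) = inj₁ k∈T
      ... | inj₂ yφ          = inj₂ yφ

  beliefSets-representatives : {Cn : FSet n → FSet n} → IsCn Cn → (S : FSet n → Set₁) →
                               (∀ {X} → S X → IsBeliefSet Cn X) → Representatives S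
  beliefSets-representatives {n} isCn S beliefSet =
    representatives truthTable (boolLists (length (valuations n))) S
      (beliefSet-resp-truthTable isCn ∘ beliefSet)
      (λ _ _ φ _ → inj₁ (truthTable-∈ φ))

module _ {a r p} {A′ : Set a} (_≼_ : A′ → A′ → Set r) (P : A′ → Set p)
         (≼-refl : ∀ {x} → P x → x ≼ x)
         (≼-trans : ∀ {x y z} → x ≼ y → y ≼ z → x ≼ z)
         (≼-total : ∀ {x y} → P x → P y → x ≼ y ⊎ y ≼ x) where

  least : ∀ {x} → P x → (ys : List A′) → All P ys → ∃ λ m → P m × m ≼ x × All (m ≼_) ys
  least px []       []         = _ , px , ≼-refl px , []
  least px (y ∷ ys) (py ∷ pys) with least px ys pys
  ... | m , pm , m≼x , m≼ys with ≼-total pm py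
  ...   | inj₁ m≼y = m , pm , m≼x , m≼y ∷ m≼ys
  ...   | inj₂ y≼m = y , py , ≼-trans y≼m m≼x , ≼-refl py ∷ All.map (≼-trans y≼m) m≼ys

-- From the postulates to a relational model

module FromPostulates (em : ExcludedMiddle (Level.suc 0ℓ))
                      {n} (Cn : FSet n → FSet n) (isCn : IsCn Cn)
                      (K : FSet n) (K-beliefSet : IsBeliefSet Cn K)
                      (∗c : ChoiceRevision n) (postulates : ChoicePostulates Cn K ∗c) where
  open ChoicePostulates postulates

  choice-⊆ : ⟦ A ⟧ ⊆ ⟦ C ⟧ → Meets A (∗c C) → ∗c A ≐ ∗c C
  choice-⊆ {A = A} {C = C} A⊆C A∩∗cC =
    reciprocity A C (Meets-⊆ˡ (regularity A C A∩∗cC) A⊆C) A∩∗cC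

  choice-++ˡ : Meets A (∗c (A ++ B)) → ∗c A ≐ ∗c (A ++ B)
  choice-++ˡ = choice-⊆ (λ _ → ∈-++⁺ˡ)

  choice-++ʳ : Meets B (∗c (A ++ B)) → ∗c B ≐ ∗c (A ++ B)
  choice-++ʳ {A = A} = choice-⊆ (λ _ → ∈-++⁺ʳ A)

  success-++ : Meets A (∗c A) → Meets (A ++ B) (∗c (A ++ B))
  success-++ {A = A} {B = B} A∩∗cA = regularity (A ++ B) A (Meets-⊆ˡ A∩∗cA (λ _ → ∈-++⁺ˡ))

  InModel : FSet n → Set
  InModel X = (X ≐ K) ⊎ (∃ λ A → Meets A (∗c A) × X ≐ ∗c A)

  _≼_ : FSet n → FSet n → Set
  X ≼ Y = (X ≐ K) ⊎ (∃ λ A → Meets A (∗c A) × X ≐ ∗c A × Meets A Y)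

  ≼-refl : InModel X → X ≼ X
  ≼-refl (inj₁ X≐K)               = inj₁ X≐K
  ≼-refl (inj₂ (A , A∩∗cA , X≐∗cA)) = inj₂ (A , A∩∗cA , X≐∗cA , Meets-⊆ʳ A∩∗cA (proj₂ X≐∗cA))

  ≼-⊆ʳ : X ≼ Y → Y ⊆ Z → X ≼ Z
  ≼-⊆ʳ (inj₁ X≐K)                       _   = inj₁ X≐K
  ≼-⊆ʳ (inj₂ (A , A∩∗cA , X≐∗cA , A∩Y)) Y⊆Z = inj₂ (A , A∩∗cA , X≐∗cA , Meets-⊆ʳ A∩Y Y⊆Z)

  ≼-total : InModel X → InModel Y → X ≼ Y ⊎ Y ≼ X
  ≼-total (inj₁ X≐K) _ = inj₁ (inj₁ X≐K)
  ≼-total _ (inj₁ Y≐K) = inj₂ (inj₁ Y≐K)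
  ≼-total (inj₂ (A , A∩∗cA , X≐∗cA)) (inj₂ (B , B∩∗cB , Y≐∗cB))
    with Meets-++⁻ A (success-++ {B = B} A∩∗cA)
  ... | inj₁ A∩∗cAB = inj₁ (inj₂ (A ++ B , success-++ A∩∗cA ,
                                  ≐-trans X≐∗cA (choice-++ˡ A∩∗cAB) ,
                                  Meets-⊆ˡ (Meets-⊆ʳ B∩∗cB (proj₂ Y≐∗cB)) (λ _ → ∈-++⁺ʳ A)))
  ... | inj₂ B∩∗cAB = inj₂ (inj₂ (A ++ B , success-++ A∩∗cA ,
                                  ≐-trans Y≐∗cB (choice-++ʳ {A = A} B∩∗cAB) ,
                                  Meets-⊆ˡ (Meets-⊆ʳ A∩∗cA (proj₂ X≐∗cA)) (λ _ → ∈-++⁺ˡ)))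

  ≼-trans : X ≼ Y → Y ≼ Z → X ≼ Z
  ≼-trans (inj₁ X≐K) _ = inj₁ X≐K
  ≼-trans (inj₂ (A , _ , X≐∗cA , A∩Y)) (inj₁ Y≐K) =
    inj₁ (≐-trans X≐∗cA (confirmation A (Meets-⊆ʳ A∩Y (proj₁ Y≐K))))
  ≼-trans (inj₂ (A , A∩∗cA , X≐∗cA , A∩Y)) (inj₂ (B , _ , Y≐∗cB , B∩Z)) =
    inj₂ (A ++ B , success-++ A∩∗cA , ≐-trans X≐∗cA (choice-++ˡ A∩∗cAB) ,
          Meets-⊆ˡ B∩Z (λ _ → ∈-++⁺ʳ A))
    where
    -- If B meets the choice from A ++ B, that choice is Y, which A meets.
    A∩∗cAB : Meets A (∗c (A ++ B))
    A∩∗cAB with Meets-++⁻ A (success-++ {B = B} A∩∗cA)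
    ... | inj₁ A∩∗cAB = A∩∗cAB
    ... | inj₂ B∩∗cAB = Meets-⊆ʳ A∩Y (proj₁ (≐-trans Y≐∗cB (choice-++ʳ {A = A} B∩∗cAB)))

  ≼-antisym : X ≼ Y → Y ≼ X → X ≐ Y
  ≼-antisym (inj₁ X≐K) (inj₁ Y≐K) = ≐-trans X≐K (≐-sym Y≐K)
  ≼-antisym (inj₁ X≐K) (inj₂ (B , _ , Y≐∗cB , B∩X)) =
    ≐-sym (≐-trans Y≐∗cB (≐-trans (confirmation B (Meets-⊆ʳ B∩X (proj₁ X≐K))) (≐-sym X≐K)))
  ≼-antisym (inj₂ (A , _ , X≐∗cA , A∩Y)) (inj₁ Y≐K) =
    ≐-trans X≐∗cA (≐-trans (confirmation A (Meets-⊆ʳ A∩Y (proj₁ Y≐K))) (≐-sym Y≐K))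
  ≼-antisym (inj₂ (A , _ , X≐∗cA , A∩Y)) (inj₂ (B , _ , Y≐∗cB , B∩X)) =
    ≐-trans X≐∗cA (≐-trans (reciprocity A B (Meets-⊆ʳ B∩X (proj₁ X≐∗cA))
                                            (Meets-⊆ʳ A∩Y (proj₁ Y≐∗cB)))
                           (≐-sym Y≐∗cB))

  InModel-beliefSet : InModel X → IsBeliefSet Cn X
  InModel-beliefSet (inj₁ X≐K)               = IsBeliefSet-resp-≐ isCn X≐K K-beliefSet
  InModel-beliefSet (inj₂ (A , _ , X≐∗cA)) = IsBeliefSet-resp-≐ isCn X≐∗cA (closure A)

  𝕏 : BSets n
  𝕏 X = Lift (Level.suc 0ℓ) (InModel X)

  _≦_ : FSet n → FSet n → Set₁
  X ≦ Y = Lift (Level.suc 0ℓ) (X ≼ Y)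

  least-in-model : (S : BSets n) → (∀ {X} → S X → 𝕏 X) → S X →
                   ∃ λ W → S W × (∀ Y → S Y → W ≼ Y)
  least-in-model S S⊆𝕏 sX
    with Ws , all-S , cover ← beliefSets-representatives em isCn S (InModel-beliefSet ∘ lower ∘ S⊆𝕏)
    with W , sW , _ , W≼Ws ← least _≼_ S (≼-refl ∘ lower ∘ S⊆𝕏) ≼-trans
                                 (λ sX sY → ≼-total (lower (S⊆𝕏 sX)) (lower (S⊆𝕏 sY)))
                                 sX Ws all-S
    = W , sW , W≼
    where
    W≼ : ∀ Y → S Y → W ≼ Y
    W≼ Y sY with W≼V , Y≐V ← lookupAny W≼Ws (cover Y sY) = ≼-⊆ʳ W≼V (proj₂ Y≐V)

  uniqueMin : ∀ Φ → (Σ (FSet n) λ X → SatIn 𝕏 Φ X) → HasUniqueMin _≦_ (SatIn 𝕏 Φ)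
  uniqueMin Φ (_ , sX) with W , sW , W≼ ← least-in-model (SatIn 𝕏 Φ) proj₁ sX =
    W , (sW , λ Y sY _ → lift (W≼ Y sY)) ,
    λ Y (sY , Y-minimal) → ≼-antisym (lower (Y-minimal W sW (lift (W≼ Y sY)))) (W≼ Y sY)

  model : RelModel Cn K
  model = record
    { 𝕏          = 𝕏
    ; _≦_        = _≦_
    ; beliefSets = λ _ → InModel-beliefSet ∘ lower
    ; K∈𝕏        = lift (inj₁ ≐-refl)
    ; K≦         = λ _ _ → lift (inj₁ ≐-refl)
    ; uniqueMin  = uniqueMin
    }

  success : (Σ (FSet n) λ X → Restrict 𝕏 A X) → Meets A (∗c A)
  success {A = A} (_ , lift (inj₁ X≐K) , A∩X) =
    Meets-⊆ʳ (Meets-⊆ʳ A∩X (proj₁ X≐K)) (proj₂ (confirmation A (Meets-⊆ʳ A∩X (proj₁ X≐K))))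
  success {A = A} (_ , lift (inj₂ (B , _ , X≐∗cB)) , A∩X) = regularity A B (Meets-⊆ʳ A∩X (proj₁ X≐∗cB))

  determines : Determines model ∗c
  determines A = (λ (_ , nonempty) → chosen (success nonempty)) , unchanged
    where
    chosen : Meets A (∗c A) → Σ (FSet n) λ X → IsMinimal _≦_ (Restrict 𝕏 A) X × (∗c A ≐ X)
    chosen A∩∗cA = ∗c A , ((lift (inj₂ (A , A∩∗cA , ≐-refl)) , A∩∗cA) ,
                           λ _ (_ , A∩Y) _ → lift (inj₂ (A , A∩∗cA , ≐-refl , A∩Y))) , ≐-refl
    unchanged : (A ≡ []) ⊎ ¬ (Σ (FSet n) λ X → Restrict 𝕏 A X) → ∗c A ≐ K
    unchanged empty with relSuccess A
    ... | inj₁ ∗cA≐K = ∗cA≐K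
    ... | inj₂ A∩∗cA with empty
    ...   | inj₁ refl = ⊥-elim (Meets-[] A∩∗cA)
    ...   | inj₂ ∄    = ⊥-elim (∄ (∗c A , lift (inj₂ (A , A∩∗cA , ≐-refl)) , A∩∗cA))

-- From a relational model to the postulates

⋁ᵈ : Formula n → List (Formula n) → MolDesc n
⋁ᵈ φ []      = 𝔅 φ
⋁ᵈ φ (ψ ∷ A) = 𝔅 φ ∨ᵈ ⋁ᵈ ψ A

SatM-⋁ᵈ⁺ : ∀ φ A → Meets (φ ∷ A) X → SatM X (⋁ᵈ φ A)
SatM-⋁ᵈ⁺ φ []      (_ , here refl , xφ) = xφ
SatM-⋁ᵈ⁺ φ (ψ ∷ A) (_ , here refl , xφ) = inj₁ xφ
SatM-⋁ᵈ⁺ φ (ψ ∷ A) (χ , there χ∈A , xχ) = inj₂ (SatM-⋁ᵈ⁺ ψ A (χ , χ∈A , xχ))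

SatM-⋁ᵈ⁻ : ∀ φ A → SatM X (⋁ᵈ φ A) → Meets (φ ∷ A) X
SatM-⋁ᵈ⁻ φ []      xφ        = φ , here refl , xφ
SatM-⋁ᵈ⁻ φ (ψ ∷ A) (inj₁ xφ) = φ , here refl , xφ
SatM-⋁ᵈ⁻ φ (ψ ∷ A) (inj₂ s) with χ , χ∈A , xχ ← SatM-⋁ᵈ⁻ ψ A s = χ , there χ∈A , xχ

module FromModel (em : ExcludedMiddle (Level.suc 0ℓ))
                 {n} (Cn : FSet n → FSet n) (isCn : IsCn Cn) (K : FSet n)
                 (∗c : ChoiceRevision n) (M : RelModel Cn K) (determined : Determines M ∗c) where
  open RelModel M

  Minimal : BSets n → FSet n → Set₁
  Minimal = IsMinimal _≦_

  Nonempty : BSets n → Set₁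
  Nonempty S = Σ (FSet n) S

  outcome : ∀ A → (¬ Nonempty (Restrict 𝕏 A) × ∗c A ≐ K)
                ⊎ (Σ (FSet n) λ X → Minimal (Restrict 𝕏 A) X × ∗c A ≐ X)
  outcome []      = inj₁ ((λ (_ , _ , []∩X) → Meets-[] []∩X) , proj₂ (determined []) (inj₁ refl))
  outcome (φ ∷ A) with em {Nonempty (Restrict 𝕏 (φ ∷ A))}
  ... | yes nonempty = inj₂ (proj₁ (determined (φ ∷ A)) ((λ ()) , nonempty))
  ... | no  empty    = inj₁ (empty , proj₂ (determined (φ ∷ A)) (inj₂ empty))

  outcome-∈𝕏 : ∀ A → Σ (FSet n) λ Y → 𝕏 Y × ∗c A ≐ Y
  outcome-∈𝕏 A with outcome A
  ... | inj₁ (_ , ∗cA≐K)                      = K , K∈𝕏 , ∗cA≐K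
  ... | inj₂ (X , ((X∈𝕏 , _) , _) , ∗cA≐X) = X , X∈𝕏 , ∗cA≐X

  Restrict-nonempty : ∀ A B → Meets A (∗c B) → Nonempty (Restrict 𝕏 A)
  Restrict-nonempty A B A∩∗cB with Y , Y∈𝕏 , ∗cB≐Y ← outcome-∈𝕏 B = Y , Y∈𝕏 , Meets-⊆ʳ A∩∗cB (proj₁ ∗cB≐Y)

  minimal-unique : ∀ Φ → Minimal (SatIn 𝕏 Φ) X → Minimal (SatIn 𝕏 Φ) Y → X ≐ Y
  minimal-unique Φ X-min Y-min with _ , _ , unique ← uniqueMin Φ (_ , proj₁ X-min) =
    ≐-trans (unique _ X-min) (≐-sym (unique _ Y-min))

  minimal-SatIn : ∀ φ A (Φ : Descriptor n) → Φ (⋁ᵈ φ A) →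
                  Minimal (Restrict 𝕏 (φ ∷ A)) X → Sat X Φ → Minimal (SatIn 𝕏 Φ) X
  minimal-SatIn φ A Φ ⋁A∈Φ ((X∈𝕏 , _) , X-min) X⊨Φ =
    (X∈𝕏 , X⊨Φ) , λ Y (Y∈𝕏 , Y⊨Φ) → X-min Y (Y∈𝕏 , SatM-⋁ᵈ⁻ φ A (Y⊨Φ _ ⋁A∈Φ))

  closure : ∀ A → Cn (∗c A) ≐ ∗c A
  closure A with Y , Y∈𝕏 , ∗cA≐Y ← outcome-∈𝕏 A =
    proj₁ (IsBeliefSet-resp-≐ isCn ∗cA≐Y (beliefSets Y Y∈𝕏)) , IsCn.inclusion isCn (∗c A)

  relSuccess : ∀ A → (∗c A ≐ K) ⊎ Meets A (∗c A)
  relSuccess A with outcome A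
  ... | inj₁ (_ , ∗cA≐K)                  = inj₁ ∗cA≐K
  ... | inj₂ (_ , ((_ , A∩X) , _) , ∗cA≐X) = inj₂ (Meets-⊆ʳ A∩X (proj₂ ∗cA≐X))

  regularity : ∀ A B → Meets A (∗c B) → Meets A (∗c A)
  regularity A B A∩∗cB with outcome A
  ... | inj₁ (empty , _)                   = ⊥-elim (empty (Restrict-nonempty A B A∩∗cB))
  ... | inj₂ (_ , ((_ , A∩X) , _) , ∗cA≐X) = Meets-⊆ʳ A∩X (proj₂ ∗cA≐X)

  confirmation : ∀ A → Meets A K → ∗c A ≐ K
  confirmation []      []∩K = ⊥-elim (Meets-[] []∩K)
  confirmation (φ ∷ A) A∩K with outcome (φ ∷ A)
  ... | inj₁ (_ , ∗cA≐K)               = ∗cA≐K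
  ... | inj₂ (X , X-min@((_ , A∩X) , _) , ∗cA≐X) =
    ≐-trans ∗cA≐X (minimal-unique Φ (minimal-SatIn φ A Φ refl X-min (λ { _ refl → SatM-⋁ᵈ⁺ φ A A∩X }))
                                    K-min)
    where
    Φ : Descriptor n
    Φ = _≡ ⋁ᵈ φ A
    K-min : Minimal (SatIn 𝕏 Φ) K
    K-min = (K∈𝕏 , λ { _ refl → SatM-⋁ᵈ⁺ φ A A∩K }) , λ Y (Y∈𝕏 , _) _ → K≦ Y Y∈𝕏

  reciprocity : ∀ A B → Meets B (∗c A) → Meets A (∗c B) → ∗c A ≐ ∗c B
  reciprocity []      _       _     []∩∗cB = ⊥-elim (Meets-[] []∩∗cB)
  reciprocity _       []      []∩∗cA _     = ⊥-elim (Meets-[] []∩∗cA)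
  reciprocity (φ ∷ A) (ψ ∷ B) B∩∗cA A∩∗cB with outcome (φ ∷ A) | outcome (ψ ∷ B)
  ... | inj₁ (empty , _) | _ = ⊥-elim (empty (Restrict-nonempty (φ ∷ A) (ψ ∷ B) A∩∗cB))
  ... | _ | inj₁ (empty , _) = ⊥-elim (empty (Restrict-nonempty (ψ ∷ B) (φ ∷ A) B∩∗cA))
  ... | inj₂ (X , X-min@((_ , A∩X) , _) , ∗cA≐X) | inj₂ (Y , Y-min@((_ , B∩Y) , _) , ∗cB≐Y) =
    ≐-trans ∗cA≐X (≐-trans (minimal-unique Φ (minimal-SatIn φ A Φ (inj₁ refl) X-min X⊨Φ)
                                             (minimal-SatIn ψ B Φ (inj₂ refl) Y-min Y⊨Φ))
                           (≐-sym ∗cB≐Y))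
    where
    Φ : Descriptor n
    Φ d = d ≡ ⋁ᵈ φ A ⊎ d ≡ ⋁ᵈ ψ B
    ⊨Φ : ∀ {Z} → Meets (φ ∷ A) Z → Meets (ψ ∷ B) Z → Sat Z Φ
    ⊨Φ A∩Z _   _ (inj₁ refl) = SatM-⋁ᵈ⁺ φ A A∩Z
    ⊨Φ _   B∩Z _ (inj₂ refl) = SatM-⋁ᵈ⁺ ψ B B∩Z
    X⊨Φ : Sat X Φ
    X⊨Φ = ⊨Φ A∩X (Meets-⊆ʳ B∩∗cA (proj₁ ∗cA≐X))
    Y⊨Φ : Sat Y Φ
    Y⊨Φ = ⊨Φ (Meets-⊆ʳ A∩∗cB (proj₁ ∗cB≐Y)) B∩Y

  postulates : ChoicePostulates Cn K ∗c
  postulates = record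
    { closure      = closure
    ; relSuccess   = relSuccess
    ; regularity   = regularity
    ; confirmation = confirmation
    ; reciprocity  = reciprocity
    }

theorem1 : ExcludedMiddle (Level.suc 0ℓ) →
           (n : ℕ) (Cn : FSet n → FSet n) → IsCn Cn →
           (K : FSet n) → IsBeliefSet Cn K → Consistent K →
           (∗c : ChoiceRevision n) →
           (ChoicePostulates Cn K ∗c → Σ (RelModel Cn K) λ M → Determines M ∗c)
           × ((Σ (RelModel Cn K) λ M → Determines M ∗c) → ChoicePostulates Cn K ∗c)
theorem1 em n Cn isCn K K-beliefSet _ ∗c =
  (λ postulates → let open FromPostulates em Cn isCn K K-beliefSet ∗c postulates
                  in model , determines) ,
  (λ (M , determined) → FromModel.postulates em Cn isCn K ∗c M determined)
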